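{- Let $\mathbf{L}$ be a tense ICRDL-algebra. Then the map $f\colon\mathsf{Con}(\mathbf{L})\to\mathsf{Con}(K(\mathbf{L}))$ defined by $f(\theta)=\gamma_\theta$, where $(a,b)\,\gamma_\theta\,(x,y)$ iff $(a,x)\in\theta$ and $(b,y)\in\theta$, is an order isomorphism.
   Context: An ICRDL-algebra is a structure $\langle L,\vee,\wedge,\cdot,\to,0,1\rangle$ such that $\langle L,\vee,\wedge,0,1\rangle$ is a bounded distributive lattice, $\langle L,\cdot,1\rangle$ is a commutative monoid, and $x\cdot y\le z$ iff $x\le y\to z$. A tense ICRDL-algebra is an ICRDL-algebra with unary operations $G,H,F,P$ satisfying: (T1) $P(x)\le y$ iff $x\le G(y)$; (T2) $F(x)\le y$ iff $x\le H(y)$; (T3) $G(0)=0$, $H(0)=0$; (T4) $G(x)\cdot F(y)\le F(x\cdot y)$ and $H(x)\cdot P(y)\le P(x\cdot y)$; (T5) $G(x\vee y)\le G(x)\vee F(y)$ and $H(x\vee y)\le H(x)\vee P(y)$; (T6) $G(x\to y)\le G(x)\to G(y)$ and $H(x\to y)\le H(x)\to H(y)$. $\mathsf{Con}$ denotes the congruence lattice ordered by inclusion. $K(\mathbf{L})$ is the tense DRL-algebra on $K(L)=\{(a,b)\in L\times L:a\cdot b=0\}$ with $(a,b)\vee(x,y)=(a\vee x,b\wedge y)$, $(a,b)\wedge(x,y)=(a\wedge x,b\vee y)$, $(a,b)\ast(x,y)=(a\cdot x,(a\to y)\wedge(x\to b))$, $\sim(a,b)=(b,a)$, $0=(0,1)$,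 $1=(1,0)$, $c=(0,0)$, $G_K(a,b)=(G(a),F(b))$, $H_K(a,b)=(H(a),P(b))$. -}

module Defs where

open import Level using (Level; _⊔_; suc)
open import Data.Product using (Σ; _×_; _,_; proj₁; proj₂)
open import Relation.Binary.PropositionalEquality
  using (_≡_; refl; sym; trans; cong; cong₂; subst)
open import Relation.Binary.Structures using (IsEquivalence)

record TenseICRDL (c : Level) : Set (suc c) where
  infixr 6 _∨_
  infixr 7 _∧_
  infixr 8 _·_
  infixr 5 _⇒_
  field
    Carrier : Set c
    _∨_ _∧_ _·_ _⇒_ : Carrier → Carrier → Carrier
    0# 1# : Carrier
    G H F P : Carrier → Carrier
    ∨-comm  : ∀ x y → x ∨ y ≡ y ∨ x
    ∨-assoc : ∀ x y z → (x ∨ y) ∨ z ≡ x ∨ (y ∨ z)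
    ∧-comm  : ∀ x y → x ∧ y ≡ y ∧ x
    ∧-assoc : ∀ x y z → (x ∧ y) ∧ z ≡ x ∧ (y ∧ z)
    ∨-absorbs-∧ : ∀ x y → x ∨ (x ∧ y) ≡ x
    ∧-absorbs-∨ : ∀ x y → x ∧ (x ∨ y) ≡ x
    ∧-distribˡ-∨ : ∀ x y z → x ∧ (y ∨ z) ≡ (x ∧ y) ∨ (x ∧ z)
    0-least    : ∀ x → 0# ∧ x ≡ 0#
    1-greatest : ∀ x → x ∧ 1# ≡ x
    ·-assoc : ∀ x y z → (x · y) · z ≡ x · (y · z)
    ·-comm  : ∀ x y → x · y ≡ y · x
    ·-identityʳ : ∀ x → x · 1# ≡ x

  infix 4 _≤_
  _≤_ : Carrier → Carrier → Set c
  x ≤ y = x ∧ y ≡ x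

  field
    residuate   : ∀ {x y z} → x · y ≤ z → x ≤ (y ⇒ z)
    unresiduate : ∀ {x y z} → x ≤ (y ⇒ z) → x · y ≤ z
    T1⇒ : ∀ {x y} → P x ≤ y → x ≤ G y
    T1⇐ : ∀ {x y} → x ≤ G y → P x ≤ y
    T2⇒ : ∀ {x y} → F x ≤ y → x ≤ H y
    T2⇐ : ∀ {x y} → x ≤ H y → F x ≤ y
    T3G : G 0# ≡ 0#
    T3H : H 0# ≡ 0#
    T4G : ∀ x y → G x · F y ≤ F (x · y)
    T4H : ∀ x y → H x · P y ≤ P (x · y)
    T5G : ∀ x y → G (x ∨ y) ≤ G x ∨ F y
    T5H : ∀ x y → H (x ∨ y) ≤ H x ∨ P y
    T6G : ∀ x y → G (x ⇒ y) ≤ G x ⇒ G y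
    T6H : ∀ x y → H (x ⇒ y) ≤ H x ⇒ H y

module Facts {c} (L : TenseICRDL c) where
  open TenseICRDL L

  ∧-idem : ∀ x → x ∧ x ≡ x
  ∧-idem x = trans (cong (x ∧_) (sym (∨-absorbs-∧ x x))) (∧-absorbs-∨ x (x ∧ x))

  ≤-refl : ∀ {x} → x ≤ x
  ≤-refl {x} = ∧-idem x

  ≤-trans : ∀ {x y z} → x ≤ y → y ≤ z → x ≤ z
  ≤-trans {x} {y} {z} p q =
    trans (cong (_∧ z) (sym p))
      (trans (∧-assoc x y z) (trans (cong (x ∧_) q) p))

  ≤-reflexive : ∀ {x y} → x ≡ y → x ≤ y
  ≤-reflexive refl = ≤-refl

  ∧-lowerˡ : ∀ x y → x ∧ y ≤ x
  ∧-lowerˡ x y =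
    trans (∧-assoc x y x)
      (trans (cong (x ∧_) (∧-comm y x))
        (trans (sym (∧-assoc x x y)) (cong (_∧ y) (∧-idem x))))

  ∧-lowerʳ : ∀ x y → x ∧ y ≤ y
  ∧-lowerʳ x y = trans (∧-assoc x y y) (cong (x ∧_) (∧-idem y))

  ∨-lub : ∀ {a x w} → a ≤ w → x ≤ w → (a ∨ x) ≤ w
  ∨-lub {a} {x} {w} p q =
    trans (∧-comm (a ∨ x) w)
      (trans (∧-distribˡ-∨ w a x)
        (cong₂ _∨_ (trans (∧-comm w a) p) (trans (∧-comm w x) q)))

  ≤0⇒≡0 : ∀ {a} → a ≤ 0# → a ≡ 0#
  ≤0⇒≡0 {a} p = trans (sym p) (trans (∧-comm a 0#) (0-least a))

  0≤ : ∀ x → 0# ≤ x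
  0≤ = 0-least

  ·-monoˡ : ∀ {x y} z → x ≤ y → x · z ≤ y · z
  ·-monoˡ z p = unresiduate (≤-trans p (residuate ≤-refl))

  ·-monoʳ : ∀ {x y} z → x ≤ y → z · x ≤ z · y
  ·-monoʳ {x} {y} z p =
    subst₂' (·-comm x z) (·-comm y z) (·-monoˡ z p)
    where
      subst₂' : ∀ {a a' b b'} → a ≡ a' → b ≡ b' → a ≤ b → a' ≤ b'
      subst₂' refl refl r = r

  mp : ∀ x b → x · (x ⇒ b) ≤ b
  mp x b = subst (_≤ b) (·-comm (x ⇒ b) x) (unresiduate ≤-refl)

  0·≡0 : ∀ y → 0# · y ≡ 0#
  0·≡0 y = ≤0⇒≡0 (unresiduate (0≤ (y ⇒ 0#)))

  F0≡0 : F 0# ≡ 0#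
  F0≡0 = ≤0⇒≡0 (T2⇐ (0≤ (H 0#)))

  P0≡0 : P 0# ≡ 0#
  P0≡0 = ≤0⇒≡0 (T1⇐ (0≤ (G 0#)))

  ∨K-ok : ∀ {a b x y} → a · b ≡ 0# → x · y ≡ 0# → (a ∨ x) · (b ∧ y) ≡ 0#
  ∨K-ok {a} {b} {x} {y} ab xy = ≤0⇒≡0 (unresiduate (∨-lub (residuate A) (residuate B)))
    where
      A : a · (b ∧ y) ≤ 0#
      A = subst (a · (b ∧ y) ≤_) ab (·-monoʳ a (∧-lowerˡ b y))
      B : x · (b ∧ y) ≤ 0#
      B = subst (x · (b ∧ y) ≤_) xy (·-monoʳ x (∧-lowerʳ b y))

  ∧K-ok : ∀ {a b x y} → a · b ≡ 0# → x · y ≡ 0# → (a ∧ x) · (b ∨ y) ≡ 0#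
  ∧K-ok {a} {b} {x} {y} ab xy =
    trans (·-comm (a ∧ x) (b ∨ y)) (≤0⇒≡0 (unresiduate (∨-lub (residuate A) (residuate B))))
    where
      A : b · (a ∧ x) ≤ 0#
      A = subst (b · (a ∧ x) ≤_) (trans (·-comm b a) ab) (·-monoʳ b (∧-lowerˡ a x))
      B : y · (a ∧ x) ≤ 0#
      B = subst (y · (a ∧ x) ≤_) (trans (·-comm y x) xy) (·-monoʳ y (∧-lowerʳ a x))

  ∗K-ok : ∀ {a b x y} → a · b ≡ 0# → x · y ≡ 0# →
          (a · x) · ((a ⇒ y) ∧ (x ⇒ b)) ≡ 0#
  ∗K-ok {a} {b} {x} {y} ab xy =
    ≤0⇒≡0 (≤-trans (·-monoʳ (a · x) (∧-lowerʳ (a ⇒ y) (x ⇒ b)))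
      (subst (_≤ 0#) (sym (·-assoc a x (x ⇒ b)))
        (subst (a · (x · (x ⇒ b)) ≤_) ab (·-monoʳ a (mp x b)))))

  GK-ok : ∀ {a b} → a · b ≡ 0# → G a · F b ≡ 0#
  GK-ok {a} {b} ab =
    ≤0⇒≡0 (subst (G a · F b ≤_) (trans (cong F ab) F0≡0) (T4G a b))

  HK-ok : ∀ {a b} → a · b ≡ 0# → H a · P b ≡ 0#
  HK-ok {a} {b} ab =
    ≤0⇒≡0 (subst (H a · P b ≤_) (trans (cong P ab) P0≡0) (T4H a b))

module _ {c} (L : TenseICRDL c) where
  open TenseICRDL L

  record IsCongruence {ℓ} (θ : Carrier → Carrier → Set ℓ) : Set (c ⊔ ℓ) where
    field
      isEquivalence : IsEquivalence θ
      ∨-cong : ∀ {a b x y} → θ a b → θ x y → θ (a ∨ x) (b ∨ y)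
      ∧-cong : ∀ {a b x y} → θ a b → θ x y → θ (a ∧ x) (b ∧ y)
      ·-cong : ∀ {a b x y} → θ a b → θ x y → θ (a · x) (b · y)
      ⇒-cong : ∀ {a b x y} → θ a b → θ x y → θ (a ⇒ x) (b ⇒ y)
      G-cong : ∀ {a b} → θ a b → θ (G a) (G b)
      H-cong : ∀ {a b} → θ a b → θ (H a) (H b)
      F-cong : ∀ {a b} → θ a b → θ (F a) (F b)
      P-cong : ∀ {a b} → θ a b → θ (P a) (P b)

  record Con (ℓ : Level) : Set (c ⊔ suc ℓ) where
    field
      rel : Carrier → Carrier → Set ℓ
      isCongruence : IsCongruence rel

module K {c} (L : TenseICRDL c) where
  open TenseICRDL L
  open Facts L

  KCarrier : Set c
  KCarrier = Σ (Carrier × Carrier) (λ p → proj₁ p · proj₂ p ≡ 0#)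

  fstK sndK : KCarrier → Carrier
  fstK k = proj₁ (proj₁ k)
  sndK k = proj₂ (proj₁ k)

  _∨K_ : KCarrier → KCarrier → KCarrier
  ((a , b) , p) ∨K ((x , y) , q) = ((a ∨ x , b ∧ y) , ∨K-ok p q)

  _∧K_ : KCarrier → KCarrier → KCarrier
  ((a , b) , p) ∧K ((x , y) , q) = ((a ∧ x , b ∨ y) , ∧K-ok p q)

  _∗K_ : KCarrier → KCarrier → KCarrier
  ((a , b) , p) ∗K ((x , y) , q) = ((a · x , (a ⇒ y) ∧ (x ⇒ b)) , ∗K-ok p q)

  ∼K : KCarrier → KCarrier
  ∼K ((a , b) , p) = ((b , a) , trans (·-comm b a) p)

  0K 1K cK : KCarrier
  0K = ((0# , 1#) , 0·≡0 1#)
  1K = ((1# , 0#) , trans (·-comm 1# 0#) (0·≡0 1#))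
  cK = ((0# , 0#) , 0·≡0 0#)

  GK HK : KCarrier → KCarrier
  GK ((a , b) , p) = ((G a , F b) , GK-ok p)
  HK ((a , b) , p) = ((H a , P b) , HK-ok p)

  -- congruences of K(L): equivalences compatible with all operations
  -- (the nullary operations 0, 1, c are trivially compatible)
  record IsKCongruence {ℓ} (Φ : KCarrier → KCarrier → Set ℓ) : Set (c ⊔ ℓ) where
    field
      isEquivalence : IsEquivalence Φ
      ∨K-cong : ∀ {k k' m m'} → Φ k k' → Φ m m' → Φ (k ∨K m) (k' ∨K m')
      ∧K-cong : ∀ {k k' m m'} → Φ k k' → Φ m m' → Φ (k ∧K m) (k' ∧K m')
      ∗K-cong : ∀ {k k' m m'} → Φ k k' → Φ m m' → Φ (k ∗K m) (k' ∗K m')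
      ∼K-cong : ∀ {k k'} → Φ k k' → Φ (∼K k) (∼K k')
      GK-cong : ∀ {k k'} → Φ k k' → Φ (GK k) (GK k')
      HK-cong : ∀ {k k'} → Φ k k' → Φ (HK k) (HK k')

  record ConK (ℓ : Level) : Set (c ⊔ suc ℓ) where
    field
      rel : KCarrier → KCarrier → Set ℓ
      isKCongruence : IsKCongruence rel

  γ : ∀ {ℓ} → (Carrier → Carrier → Set ℓ) → KCarrier → KCarrier → Set ℓ
  γ θ k m = θ (fstK k) (fstK m) × θ (sndK k) (sndK m)

_⊆ᵣ_ : ∀ {a ℓ₁ ℓ₂} {A : Set a} → (A → A → Set ℓ₁) → (A → A → Set ℓ₂) → Set (a ⊔ ℓ₁ ⊔ ℓ₂)
R ⊆ᵣ S = ∀ {x y} → R x y → S x y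

{-# OPTIONS --safe #-}
module Submission where

-- A congruence Φ of K(L) is determined by its trace on the copy ι a = (a , 0) of L:
-- joining with c = (0 , 0) projects (a , b) to ι a, and the involution ∼ moves the
-- second coordinate into the first, so Φ relates two pairs only if their coordinates
-- are related in that trace. Conversely, coordinatewise related pairs k, m are both
-- Φ-related to their coordinatewise meet, obtained from each by one join with ∼ ι _
-- and one meet with ι _. The trace is a congruence of L because every operation of L
-- is read off the first coordinate of a term of K(L); for ⇒ this uses that 0 ⇒ 0 is
-- the top element.

open import Defs
open import Data.Product using (Σ; _×_; _,_; proj₁)
open import Relation.Binary.PropositionalEquality
  using (_≡_; refl; sym; trans; cong; subst; subst₂)
open import Relation.Binary.Core using (Rel)
open import Relation.Binary.Definitions using (Reflexive)
open import Relation.Binary.Structures using (IsEquivalence)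
open import Axiom.UniquenessOfIdentityProofs.WithK using (uip)

module _ {c} (L : TenseICRDL c) where
  open TenseICRDL L
  open Facts L
  open K L

  ∨-idem : ∀ x → x ∨ x ≡ x
  ∨-idem x = trans (cong (x ∨_) (sym (∧-idem x))) (∨-absorbs-∧ x x)

  ∧-zeroʳ : ∀ x → x ∧ 0# ≡ 0#
  ∧-zeroʳ x = trans (∧-comm x 0#) (0-least x)

  ∨-identityʳ : ∀ x → x ∨ 0# ≡ x
  ∨-identityʳ x = trans (cong (x ∨_) (sym (∧-zeroʳ x))) (∨-absorbs-∧ x 0#)

  ·-zeroʳ : ∀ x → x · 0# ≡ 0#
  ·-zeroʳ x = trans (·-comm x 0#) (0·≡0 x)

  0⇒0-greatest : ∀ x → x ≤ (0# ⇒ 0#)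
  0⇒0-greatest x = residuate (subst (_≤ 0#) (sym (·-zeroʳ x)) ≤-refl)

  K-≡ : ∀ {k m : KCarrier} → fstK k ≡ fstK m → sndK k ≡ sndK m → k ≡ m
  K-≡ {(a , b) , p} {(.a , .b) , q} refl refl = cong ((a , b) ,_) (uip p q)

  ι : Carrier → KCarrier
  ι a = (a , 0#) , ·-zeroʳ a

  ∨K-c≡ι-fst : ∀ k → k ∨K cK ≡ ι (fstK k)
  ∨K-c≡ι-fst k = K-≡ (∨-identityʳ (fstK k)) (∧-zeroʳ (sndK k))

  ⇒-as-fst : ∀ a x → fstK (∼K (ι a ∗K ∼K (ι x))) ≡ a ⇒ x
  ⇒-as-fst a x = 0⇒0-greatest (a ⇒ x)

  infixr 7 _⊓_
  _⊓_ : KCarrier → KCarrier → KCarrier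
  ((a , b) , p) ⊓ ((x , y) , _) = (a ∧ x , b ∧ y) , ⊓-ok
    where
      ⊓-ok : (a ∧ x) · (b ∧ y) ≡ 0#
      ⊓-ok = ≤0⇒≡0 (subst ((a ∧ x) · (b ∧ y) ≤_) p
        (≤-trans (·-monoˡ (b ∧ y) (∧-lowerˡ a x)) (·-monoʳ a (∧-lowerˡ b y))))

  ⊓-comm : ∀ k m → k ⊓ m ≡ m ⊓ k
  ⊓-comm k m = K-≡ (∧-comm (fstK k) (fstK m)) (∧-comm (sndK k) (sndK m))

  module _ {ℓ} {θ : Rel Carrier ℓ} where

    γ-isKCongruence : IsCongruence L θ → IsKCongruence (γ θ)
    γ-isKCongruence θ-cong = record
      { isEquivalence = record
          { refl  = refl′ , refl′
          ; sym   = λ (p , q) → sym′ p , sym′ q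
          ; trans = λ (p , q) (p′ , q′) → trans′ p p′ , trans′ q q′
          }
      ; ∨K-cong = λ (p , q) (p′ , q′) → ∨-cong p p′ , ∧-cong q q′
      ; ∧K-cong = λ (p , q) (p′ , q′) → ∧-cong p p′ , ∨-cong q q′
      ; ∗K-cong = λ (p , q) (p′ , q′) → ·-cong p p′ , ∧-cong (⇒-cong p q′) (⇒-cong p′ q)
      ; ∼K-cong = λ (p , q) → q , p
      ; GK-cong = λ (p , q) → G-cong p , F-cong q
      ; HK-cong = λ (p , q) → H-cong p , P-cong q
      }
      where
        open IsCongruence θ-cong
        open IsEquivalence isEquivalence
          renaming (refl to refl′; sym to sym′; trans to trans′)

    γ-mono : ∀ {ℓ′} {θ′ : Rel Carrier ℓ′} → θ ⊆ᵣ θ′ → γ θ ⊆ᵣ γ θ′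
    γ-mono θ⊆θ′ (p , q) = θ⊆θ′ p , θ⊆θ′ q

    γ-reflects-⊆ : ∀ {ℓ′} {θ′ : Rel Carrier ℓ′} →
                   Reflexive θ → γ θ ⊆ᵣ γ θ′ → θ ⊆ᵣ θ′
    γ-reflects-⊆ θ-refl γθ⊆γθ′ {a} {b} p = proj₁ (γθ⊆γθ′ {ι a} {ι b} (p , θ-refl))

  ι⁻¹ : ∀ {ℓ} → Rel KCarrier ℓ → Rel Carrier ℓ
  ι⁻¹ Φ a b = Φ (ι a) (ι b)

  module _ {ℓ} {Φ : Rel KCarrier ℓ} (Φ-cong : IsKCongruence Φ) where
    open IsKCongruence Φ-cong
    open IsEquivalence isEquivalence
      renaming (refl to Φ-refl; sym to Φ-sym; trans to Φ-trans)

    ι⁻¹-fst : ∀ {k m} → Φ k m → ι⁻¹ Φ (fstK k) (fstK m)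
    ι⁻¹-fst {k} {m} r =
      subst₂ Φ (∨K-c≡ι-fst k) (∨K-c≡ι-fst m) (∨K-cong r (Φ-refl {cK}))

    ι⁻¹-snd : ∀ {k m} → Φ k m → ι⁻¹ Φ (sndK k) (sndK m)
    ι⁻¹-snd r = ι⁻¹-fst (∼K-cong r)

    ι⁻¹-isCongruence : IsCongruence L (ι⁻¹ Φ)
    ι⁻¹-isCongruence = record
      { isEquivalence = record { refl = Φ-refl ; sym = Φ-sym ; trans = Φ-trans }
      ; ∨-cong = λ p q → subst₂ Φ (ι-∨ _ _) (ι-∨ _ _) (∨K-cong p q)
      ; ∧-cong = λ p q → subst₂ Φ (ι-∧ _ _) (ι-∧ _ _) (∧K-cong p q)
      ; ·-cong = λ p q → ι⁻¹-fst (∗K-cong p q)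
      ; ⇒-cong = λ {a} {b} {x} {y} p q →
          subst₂ (ι⁻¹ Φ) (⇒-as-fst a x) (⇒-as-fst b y)
            (ι⁻¹-fst (∼K-cong (∗K-cong p (∼K-cong q))))
      ; G-cong = λ p → ι⁻¹-fst (GK-cong p)
      ; H-cong = λ p → ι⁻¹-fst (HK-cong p)
      ; F-cong = λ p → ι⁻¹-snd (GK-cong (∼K-cong p))
      ; P-cong = λ p → ι⁻¹-snd (HK-cong (∼K-cong p))
      }
      where
        ι-∨ : ∀ a x → ι a ∨K ι x ≡ ι (a ∨ x)
        ι-∨ a x = K-≡ refl (∧-idem 0#)

        ι-∧ : ∀ a x → ι a ∧K ι x ≡ ι (a ∧ x)
        ι-∧ a x = K-≡ refl (∨-idem 0#)

    Φ-⊓ : ∀ {k m} → γ (ι⁻¹ Φ) k m → Φ k (k ⊓ m)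
    Φ-⊓ {k@((a , b) , _)} {m@((x , y) , _)} (ra , rb) =
      subst₂ Φ left right (∧K-cong (∨K-cong (Φ-refl {k}) (∼K-cong rb)) ra)
      where
        left : (k ∨K ∼K (ι b)) ∧K ι a ≡ k
        left = K-≡ (trans (cong (_∧ a) (∨-identityʳ a)) (∧-idem a))
                   (trans (∨-identityʳ (b ∧ b)) (∧-idem b))

        right : (k ∨K ∼K (ι y)) ∧K ι x ≡ k ⊓ m
        right = K-≡ (cong (_∧ x) (∨-identityʳ a)) (∨-identityʳ (b ∧ y))

    γ-ι⁻¹⊆ : γ (ι⁻¹ Φ) ⊆ᵣ Φ
    γ-ι⁻¹⊆ {k} {m} (ra , rb) =
      Φ-trans (Φ-⊓ {k} {m} (ra , rb))
        (Φ-sym (subst (Φ m) (⊓-comm m k) (Φ-⊓ {m} {k} (Φ-sym ra , Φ-sym rb))))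

    ⊆γ-ι⁻¹ : Φ ⊆ᵣ γ (ι⁻¹ Φ)
    ⊆γ-ι⁻¹ r = ι⁻¹-fst r , ι⁻¹-snd r

mainTheorem15 : ∀ {c ℓ} (L : TenseICRDL c) →
    let open K L in
    -- f is well defined: γ_θ ∈ Con(K(L)) for every θ ∈ Con(L)
    ((θ : Con L ℓ) → IsKCongruence (γ (Con.rel θ)))
    -- f is an order embedding: θ ⊆ θ' iff γ_θ ⊆ γ_θ'
    × ((θ θ' : Con L ℓ) →
        (Con.rel θ ⊆ᵣ Con.rel θ' → γ (Con.rel θ) ⊆ᵣ γ (Con.rel θ'))
        × (γ (Con.rel θ) ⊆ᵣ γ (Con.rel θ') → Con.rel θ ⊆ᵣ Con.rel θ'))
    -- f is onto: every congruence of K(L) is γ_θ for some θ ∈ Con(L)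
    × ((Φ : ConK ℓ) → Σ (Con L ℓ) (λ θ →
        (γ (Con.rel θ) ⊆ᵣ ConK.rel Φ) × (ConK.rel Φ ⊆ᵣ γ (Con.rel θ))))
mainTheorem15 L =
    (λ θ → γ-isKCongruence L (Con.isCongruence θ))
  , (λ θ θ′ → γ-mono L , γ-reflects-⊆ L (reflexive θ))
  , λ Φ → let Φ-cong = K.ConK.isKCongruence Φ in
      record { rel = ι⁻¹ L (K.ConK.rel Φ) ; isCongruence = ι⁻¹-isCongruence L Φ-cong }
      , γ-ι⁻¹⊆ L Φ-cong , ⊆γ-ι⁻¹ L Φ-cong
  where
    reflexive : ∀ {c ℓ} {L : TenseICRDL c} (θ : Con L ℓ) → Reflexive (Con.rel θ)
    reflexive θ = IsEquivalence.refl (IsCongruence.isEquivalence (Con.isCongruence θ))
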